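{- Let $G$ be a finite graph and let $\pi$ be a monotone lion strategy that clears $G$ using $k$ lions. Then $\partial(C_t)\subseteq L_t$ for every $t\ge0$.
   Context: Lions and contamination game on a finite graph $G=(V,E)$. For $S\subseteq V$, $N(S)=\{w\in V\setminus S:\exists v\in S,\{v,w\}\in E\}$ and $\partial(S)=\{w\in S: w\text{ has a neighbour in }N(S)\}$; $N(v)=N(\{v\})$. A lion strategy with $k\ge1$ lions: initial positions $p_i(0)$, and $p_i(t)\in\{p_i(t-1)\}\cup N(p_i(t-1))$ for $t\ge1$; $L_t=\{p_i(t)\}_i$, $\pi_t=\{(p_i(t-1),p_i(t))\}_i$. Contaminated sets: $W_0=V\setminus L_0$; $W_t=(W_{t-1}\setminus L_t)\cup\{v\in V\setminus L_t:\exists w\in W_{t-1}\cap N(v),\ (v,w)\notin\pi_t,(w,v)\notin\pi_t\}$; cleared sets $C_t=V\setminus W_t$. The strategy clears $G$ if $W_T=\emptyset$ for some $T$, and is monotone if $W_t\subseteq W_{t-1}$ for all $t\ge1$. -}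

module Defs where

open import Data.Nat using (ℕ; zero; suc; _≤_)
open import Data.Fin using (Fin; zero; suc; _≟_)
open import Data.Fin.Subset using (Subset; ∁; _⊆_; ⊥) public
open import Data.Bool using (Bool; true; false; _∧_; _∨_; not)
open import Data.Vec using (lookup; tabulate)
open import Data.Product using (∃)
open import Data.Sum using (_⊎_)
open import Relation.Nullary.Decidable using (⌊_⌋)
open import Relation.Binary.PropositionalEquality using (_≡_)

anyFin : {n : ℕ} → (Fin n → Bool) → Bool
anyFin {zero}  f = false
anyFin {suc n} f = f zero ∨ anyFin (λ i → f (suc i))

record Graph : Set where
  field
    n      : ℕ
    adj    : Fin n → Fin n → Bool
    sym    : ∀ u v → adj u v ≡ adj v u
    irrefl : ∀ v → adj v v ≡ false

module _ (G : Graph) where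
  open Graph G

  Edge : Fin n → Fin n → Set
  Edge u v = adj u v ≡ true

  Nbhd : Subset n → Subset n
  Nbhd S = tabulate λ w → not (lookup S w) ∧ anyFin (λ v → lookup S v ∧ adj v w)

  Boundary : Subset n → Subset n
  Boundary S = tabulate λ w → lookup S w ∧ anyFin (λ u → lookup (Nbhd S) u ∧ adj w u)

  record Strategy : Set where
    field
      k     : ℕ
      k≥1   : 1 ≤ k
      pos   : Fin k → ℕ → Fin n
      valid : ∀ i t → pos i (suc t) ≡ pos i t ⊎ Edge (pos i t) (pos i (suc t))

  module _ (σ : Strategy) where
    open Strategy σ

    Lions : ℕ → Subset n
    Lions t = tabulate λ v → anyFin (λ i → ⌊ pos i t ≟ v ⌋)

    moved : ℕ → Fin n → Fin n → Bool
    moved t u v = anyFin (λ i → ⌊ pos i t ≟ u ⌋ ∧ ⌊ pos i (suc t) ≟ v ⌋)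

    Contam : ℕ → Subset n
    Contam zero    = ∁ (Lions zero)
    Contam (suc t) = tabulate λ v →
      not (lookup (Lions (suc t)) v) ∧
      (lookup (Contam t) v ∨
        anyFin (λ w → lookup (Contam t) w ∧ adj v w ∧
                      not (moved t v w) ∧ not (moved t w v)))

    Cleared : ℕ → Subset n
    Cleared t = ∁ (Contam t)

    Clears : Set
    Clears = ∃ λ T → Contam T ≡ ⊥

    Monotone : Set
    Monotone = ∀ t → Contam (suc t) ⊆ Contam t

-- A vertex w of ∂(C_t) has a contaminated neighbour u.  At t = 0 every cleared
-- vertex carries a lion.  At t = s + 1, monotonicity puts u in W_s, so u is
-- lion-free at times s and s + 1 and no lion can traverse the edge {w,u} during
-- that step; were w lion-free at s + 1, the contamination of u would spread to w.

module Submission where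

open import Defs
open import Data.Nat using (ℕ; zero; suc)
open import Data.Fin using (Fin; zero; suc; _≟_)
open import Data.Fin.Subset using (_∈_; _∉_)
open import Data.Fin.Subset.Properties using (_∈?_; x∈∁p⇒x∉p; x∉∁p⇒x∈p)
open import Data.Bool using (Bool; true; false; T; not; _∧_)
open import Data.Bool.Properties using (T-≡; T-∧; T-∨)
open import Data.Vec using (lookup; tabulate)
open import Data.Vec.Properties using (lookup∘tabulate; []=⇒lookup; lookup⇒[]=)
open import Data.Product using (∃; _,_; _×_; proj₁; proj₂)
open import Data.Sum using (inj₁; inj₂)
open import Function.Bundles using (Equivalence)
open import Relation.Nullary using (¬_; yes; no; contradiction)
open import Relation.Nullary.Decidable using (⌊_⌋; fromWitness)
open import Relation.Binary.PropositionalEquality using (refl; sym; subst)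

open Equivalence using (to; from)

T-not⇒¬T : ∀ {b} → T (not b) → ¬ T b
T-not⇒¬T {false} _ ()

¬T⇒T-not : ∀ {b} → ¬ T b → T (not b)
¬T⇒T-not {false} _   = _
¬T⇒T-not {true}  ¬tt = ¬tt _

anyFin⁺ : ∀ {n} (f : Fin n → Bool) i → T (f i) → T (anyFin f)
anyFin⁺ f zero    fi = from T-∨ (inj₁ fi)
anyFin⁺ f (suc i) fi = from T-∨ (inj₂ (anyFin⁺ (λ j → f (suc j)) i fi))

anyFin⁻ : ∀ {n} (f : Fin n → Bool) → T (anyFin f) → ∃ λ i → T (f i)
anyFin⁻ {suc n} f any with to T-∨ any
... | inj₁ f0 = zero , f0
... | inj₂ fs with anyFin⁻ (λ j → f (suc j)) fs
...   | i , fi = suc i , fi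

module _ {n : ℕ} where

  ∈⇒T-lookup : ∀ {p} {x : Fin n} → x ∈ p → T (lookup p x)
  ∈⇒T-lookup x∈p = from T-≡ ([]=⇒lookup x∈p)

  T-lookup⇒∈ : ∀ {p} {x : Fin n} → T (lookup p x) → x ∈ p
  T-lookup⇒∈ {x = x} px = lookup⇒[]= x _ (to T-≡ px)

  T-not-lookup⇒∉ : ∀ {p} {x : Fin n} → T (not (lookup p x)) → x ∉ p
  T-not-lookup⇒∉ ¬px x∈p = T-not⇒¬T ¬px (∈⇒T-lookup x∈p)

  ∉⇒T-not-lookup : ∀ {p} {x : Fin n} → x ∉ p → T (not (lookup p x))
  ∉⇒T-not-lookup x∉p = ¬T⇒T-not (λ px → x∉p (T-lookup⇒∈ px))

  ∈-tabulate⁺ : ∀ {f : Fin n → Bool} {x} → T (f x) → x ∈ tabulate f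
  ∈-tabulate⁺ {f} {x} fx = T-lookup⇒∈ (subst T (sym (lookup∘tabulate f x)) fx)

  ∈-tabulate⁻ : ∀ {f : Fin n → Bool} {x} → x ∈ tabulate f → T (f x)
  ∈-tabulate⁻ {f} {x} x∈ = subst T (lookup∘tabulate f x) (∈⇒T-lookup x∈)

module _ (G : Graph) where
  open Graph G using (adj)

  ∈Boundary⁻ : ∀ {S w} → w ∈ Boundary G S → w ∈ S × ∃ λ u → Edge G w u × u ∉ S
  ∈Boundary⁻ w∈∂S with to T-∧ (∈-tabulate⁻ w∈∂S)
  ... | w∈S , hasNeighbour with anyFin⁻ _ hasNeighbour
  ...   | u , u∈N×w~u with to T-∧ u∈N×w~u
  ...     | u∈N , w~u =
    T-lookup⇒∈ w∈S , u , to T-≡ w~u ,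
    T-not-lookup⇒∉ (proj₁ (to T-∧ (subst T (lookup∘tabulate _ u) u∈N)))

  module _ (σ : Strategy G) where
    open Strategy σ using (pos)

    pos∈Lions : ∀ i t → pos i t ∈ Lions G σ t
    pos∈Lions i t = ∈-tabulate⁺ (anyFin⁺ _ i (fromWitness refl))

    moved⇒∈Lions : ∀ {t u v} → T (moved G σ t u v) →
                   u ∈ Lions G σ t × v ∈ Lions G σ (suc t)
    moved⇒∈Lions {t} {u} {v} move
      with anyFin⁻ (λ i → ⌊ pos i t ≟ u ⌋ ∧ ⌊ pos i (suc t) ≟ v ⌋) move
    ... | i , atBoth with pos i t ≟ u | pos i (suc t) ≟ v | atBoth
    ...   | yes refl | yes refl | _ = pos∈Lions i t , pos∈Lions i (suc t)
    ...   | yes _    | no _     | ()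
    ...   | no _     | _        | ()

    Contam⇒∉Lions : ∀ {t v} → v ∈ Contam G σ t → v ∉ Lions G σ t
    Contam⇒∉Lions {zero}  v∈W = x∈∁p⇒x∉p v∈W
    Contam⇒∉Lions {suc t} v∈W = T-not-lookup⇒∉ (proj₁ (to T-∧ (∈-tabulate⁻ v∈W)))

    Contam-spreads : ∀ {t v w} → Edge G v w → w ∈ Contam G σ t →
                     w ∉ Lions G σ (suc t) → v ∉ Lions G σ (suc t) →
                     v ∈ Contam G σ (suc t)
    Contam-spreads {t} {v} {w} v~w w∈W w∉L′ v∉L′ =
      ∈-tabulate⁺ (from T-∧ (∉⇒T-not-lookup v∉L′ , from T-∨ (inj₂ spread)))
      where
      notTraversed : T (not (moved G σ t v w)) × T (not (moved G σ t w v))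
      notTraversed = ¬T⇒T-not (λ vw → w∉L′ (proj₂ (moved⇒∈Lions vw)))
                   , ¬T⇒T-not (λ wv → Contam⇒∉Lions w∈W (proj₁ (moved⇒∈Lions wv)))

      spread : T (anyFin λ x → lookup (Contam G σ t) x ∧ adj v x ∧
                               not (moved G σ t v x) ∧ not (moved G σ t x v))
      spread = anyFin⁺ _ w (from T-∧ (∈⇒T-lookup w∈W ,
                 from T-∧ (from T-≡ v~w , from T-∧ notTraversed)))

    Cleared-beside-Contam⇒∈Lions : Monotone G σ → ∀ {t w u} →
      w ∈ Cleared G σ t → Edge G w u → u ∈ Contam G σ t → w ∈ Lions G σ t
    Cleared-beside-Contam⇒∈Lions mono {zero} w∈C _ _ = x∉∁p⇒x∈p (x∈∁p⇒x∉p w∈C)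
    Cleared-beside-Contam⇒∈Lions mono {suc s} {w} {u} w∈C w~u u∈W
      with w ∈? Lions G σ (suc s)
    ... | yes w∈L = w∈L
    ... | no  w∉L = contradiction w∈W (x∈∁p⇒x∉p w∈C)
      where
      w∈W : w ∈ Contam G σ (suc s)
      w∈W = Contam-spreads w~u (mono s u∈W) (Contam⇒∉Lions u∈W) w∉L

lemma23 : (G : Graph) (σ : Strategy G) → Monotone G σ → Clears G σ →
          (t : ℕ) → Boundary G (Cleared G σ t) ⊆ Lions G σ t
lemma23 G σ mono _ t w∈∂C with ∈Boundary⁻ G w∈∂C
... | w∈C , u , w~u , u∉C =
  Cleared-beside-Contam⇒∈Lions G σ mono w∈C w~u (x∉∁p⇒x∈p u∉C)
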